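{- Let $k$ and $s$ be positive integers with $s$ even. If $k\le (s^2-s)/2$, then $\mathbb{Z}_2\times\mathbb{Z}_{2k}$ has an $s$-spanning set of size $2$.
   Context: $\mathbb{Z}_n=\mathbb{Z}/n\mathbb{Z}$. A subset $A=\{a_1,a_2\}$ of an abelian group $G$ is an $s$-spanning set if every element of $G$ equals $\lambda_1a_1+\lambda_2a_2$ for some integers $\lambda_1,\lambda_2$ with $|\lambda_1|+|\lambda_2|\le s$. -}

module Defs where

open import Data.Nat as ℕ using (ℕ; _≤_)
open import Data.Integer as ℤ using (ℤ; +_; ∣_∣)
open import Data.Integer.Divisibility as ℤDiv using ()
open import Data.Fin using (Fin; toℕ)
open import Data.Product using (Σ; _×_; ∃₂)
open import Relation.Binary.PropositionalEquality using (_≢_)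

_≡[mod_]_ : ℤ → ℕ → ℤ → Set
a ≡[mod n ] b = (+ n) ℤDiv.∣ (a ℤ.- b)

G : ℕ → Set
G k = Fin 2 × Fin (2 ℕ.* k)

fst : (k : ℕ) → G k → ℤ
fst k (x Data.Product., _) = + toℕ x

snd : (k : ℕ) → G k → ℤ
snd k (_ Data.Product., y) = + toℕ y

IsComb : (k : ℕ) → ℤ → G k → ℤ → G k → G k → Set
IsComb k l₁ a₁ l₂ a₂ g =
  (l₁ ℤ.* fst k a₁ ℤ.+ l₂ ℤ.* fst k a₂) ≡[mod 2 ] fst k g
  × (l₁ ℤ.* snd k a₁ ℤ.+ l₂ ℤ.* snd k a₂) ≡[mod (2 ℕ.* k) ] snd k g

IsSSpanning : (k s : ℕ) → G k → G k → Set
IsSSpanning k s a₁ a₂ =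
  (g : G k) → ∃₂ λ (l₁ l₂ : ℤ) → (∣ l₁ ∣ ℕ.+ ∣ l₂ ∣ ≤ s) × IsComb k l₁ a₁ l₂ a₂ g

HasSSpanningSetOfSize2 : (k s : ℕ) → Set
HasSSpanningSetOfSize2 k s =
  Σ (G k) λ a₁ → Σ (G k) λ a₂ → (a₁ ≢ a₂) × IsSSpanning k s a₁ a₂

-- Write s = 2r and take the generators (1, r) and (1, r − 1). A combination l₁ r + l₂ (r − 1)
-- has ℤ₂-coordinate l₁ + l₂ mod 2; in terms of u = l₁ + l₂ and v = l₁ − l₂ it equals
-- (u (2r − 1) + v) / 2, and ∣ l₁ ∣ + ∣ l₂ ∣ = max (∣ u ∣ , ∣ v ∣). Dividing by 2r − 1 (with the
-- remainder allowed to reach the divisor) therefore represents every integer of absolute value at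
-- most r (2r − 1) with ∣ l₁ ∣ + ∣ l₂ ∣ ≤ 2r and l₁ + l₂ of either parity. Since 2k ≤ 2r (2r − 1),
-- every residue modulo 2k has a representative of that size.

module Submission where

open import Defs
open import Data.Nat using (ℕ; _≤_; _*_; _∸_; _/_)
open import Data.Nat.Divisibility using (_∣_)

open import Data.Nat as ℕ using (zero; suc; z≤n; s≤s; _<_; _≤?_)
import Data.Nat.Properties as ℕₚ
open import Data.Nat.DivMod as DM using (_%_; _mod_; m≡m%n+[m/n]*n)
open import Data.Nat.Divisibility using (divides; ∣1⇒≡1)
open import Data.Integer as ℤ using (ℤ; +_; -[1+_]; _⊖_; 1ℤ)
import Data.Integer.Properties as ℤₚ
import Data.Integer.Divisibility.Signed as ℤ∣
open import Data.Integer.Tactic.RingSolver using (solve-∀)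
open import Data.Nat.Tactic.RingSolver using () renaming (solve-∀ to ℕsolve-∀)
open import Data.Fin as Fin using (Fin; toℕ)
open import Data.Fin.Properties using (toℕ-fromℕ<; toℕ<n)
open import Data.Product using (∃; ∃₂; _×_; _,_; proj₂)
open import Data.Sum using (inj₁; inj₂)
open import Relation.Nullary using (yes; no)
open import Relation.Binary.PropositionalEquality

∣m⊖n∣≤o : ∀ {m n o} → m ≤ n ℕ.+ o → n ≤ m ℕ.+ o → ℤ.∣ m ⊖ n ∣ ≤ o
∣m⊖n∣≤o {m} {n} {o} m≤n+o n≤m+o with ℕₚ.≤-total n m
... | inj₁ n≤m = begin
  ℤ.∣ m ⊖ n ∣ ≡⟨ cong ℤ.∣_∣ (ℤₚ.⊖-≥ n≤m) ⟩
  m ∸ n       ≤⟨ ℕₚ.m≤n+o⇒m∸n≤o m n m≤n+o ⟩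
  o           ∎
  where open ℕₚ.≤-Reasoning
... | inj₂ m≤n = begin
  ℤ.∣ m ⊖ n ∣ ≡⟨ ℤₚ.∣m⊖n∣≡∣n⊖m∣ m n ⟩
  ℤ.∣ n ⊖ m ∣ ≡⟨ cong ℤ.∣_∣ (ℤₚ.⊖-≥ m≤n) ⟩
  n ∸ m       ≤⟨ ℕₚ.m≤n+o⇒m∸n≤o n m n≤m+o ⟩
  o           ∎
  where open ℕₚ.≤-Reasoning

-- ∣ i ∣ + ∣ j ∣ is the larger of ∣ i + j ∣ and ∣ i - j ∣.
∣i+j∣≤n⇒∣i-j∣≤n⇒∣i∣+∣j∣≤n : ∀ i j {n} → ℤ.∣ i ℤ.+ j ∣ ≤ n → ℤ.∣ i ℤ.- j ∣ ≤ n →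
                             ℤ.∣ i ∣ ℕ.+ ℤ.∣ j ∣ ≤ n
∣i+j∣≤n⇒∣i-j∣≤n⇒∣i∣+∣j∣≤n (+ x)    (+ y)    ∣i+j∣≤n _ = ∣i+j∣≤n
∣i+j∣≤n⇒∣i-j∣≤n⇒∣i∣+∣j∣≤n (+ x)    -[1+ y ] _ ∣i-j∣≤n = ∣i-j∣≤n
∣i+j∣≤n⇒∣i-j∣≤n⇒∣i∣+∣j∣≤n -[1+ x ] (+ y) {n} _ ∣i-j∣≤n =
  subst (_≤ n) (trans (ℤₚ.∣i-j∣≡∣j-i∣ -[1+ x ] (+ y)) (ℕₚ.+-comm y (suc x))) ∣i-j∣≤n
∣i+j∣≤n⇒∣i-j∣≤n⇒∣i∣+∣j∣≤n -[1+ x ] -[1+ y ] {n} ∣i+j∣≤n _ =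
  subst (_≤ n) (cong suc (sym (ℕₚ.+-suc x y))) ∣i+j∣≤n

pos-*-+ : ∀ a b c → + (a * b ℕ.+ c) ≡ + a ℤ.* + b ℤ.+ + c
pos-*-+ a b c = trans (ℤₚ.pos-+ (a * b) c) (cong (ℤ._+ + c) (ℤₚ.pos-* a b))

pos-+-* : ∀ a b c → + (a ℕ.+ b * c) ≡ + a ℤ.+ + b ℤ.* + c
pos-+-* a b c = trans (ℤₚ.pos-+ a (b * c)) (cong (ℤ._+_ (+ a)) (ℤₚ.pos-* b c))

-- _≡[mod_]_ unfolds to a divisibility of absolute values, from which Agda cannot recover
-- the integers involved; the congruence lemmas therefore take them explicitly.
≡[mod]⇒∣ : ∀ {n} i j → i ≡[mod n ] j → + n ℤ∣.∣ (i ℤ.- j)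
≡[mod]⇒∣ {n} i j = ℤ∣.∣ᵤ⇒∣ {+ n} {i ℤ.- j}

∣⇒≡[mod] : ∀ {n} i j → + n ℤ∣.∣ (i ℤ.- j) → i ≡[mod n ] j
∣⇒≡[mod] {n} i j = ℤ∣.∣⇒∣ᵤ {+ n} {i ℤ.- j}

≡⇒≡[mod] : ∀ {n} i j → i ≡ j → i ≡[mod n ] j
≡⇒≡[mod] i _ refl = ∣⇒≡[mod] i i (ℤ∣.divides ℤ.0ℤ (ℤₚ.+-inverseʳ i))

≡[mod]-trans : ∀ {n} i j k → i ≡[mod n ] j → j ≡[mod n ] k → i ≡[mod n ] k
≡[mod]-trans {n} i j k i≡j j≡k = ∣⇒≡[mod] i k (subst (+ n ℤ∣.∣_) (telescope i j k)
  (ℤ∣.∣m∣n⇒∣m+n (≡[mod]⇒∣ i j i≡j) (≡[mod]⇒∣ j k j≡k)))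
  where
  telescope : ∀ i j k → (i ℤ.- j) ℤ.+ (j ℤ.- k) ≡ i ℤ.- k
  telescope = solve-∀

-‿cong-≡[mod] : ∀ {n} i j → i ≡[mod n ] j → (ℤ.- i) ≡[mod n ] (ℤ.- j)
-‿cong-≡[mod] {n} i j i≡j = ∣⇒≡[mod] (ℤ.- i) (ℤ.- j)
  (subst (+ n ℤ∣.∣_) (negate i j) (ℤ∣.∣m⇒∣-m (≡[mod]⇒∣ i j i≡j)))
  where
  negate : ∀ i j → ℤ.- (i ℤ.- j) ≡ ℤ.- i ℤ.- ℤ.- j
  negate = solve-∀

-i≡i[mod2] : ∀ i → (ℤ.- i) ≡[mod 2 ] i
-i≡i[mod2] i = ∣⇒≡[mod] (ℤ.- i) i (ℤ∣.divides (ℤ.- i) (double i))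
  where
  double : ∀ i → ℤ.- i ℤ.- i ≡ ℤ.- i ℤ.* + 2
  double = solve-∀

lincomb-≡[mod] : ∀ {n} l₁ l₂ a a′ b b′ → a ≡[mod n ] a′ → b ≡[mod n ] b′ →
                 (l₁ ℤ.* a ℤ.+ l₂ ℤ.* b) ≡[mod n ] (l₁ ℤ.* a′ ℤ.+ l₂ ℤ.* b′)
lincomb-≡[mod] {n} l₁ l₂ a a′ b b′ a≡a′ b≡b′ = ∣⇒≡[mod] (l₁ ℤ.* a ℤ.+ l₂ ℤ.* b) (l₁ ℤ.* a′ ℤ.+ l₂ ℤ.* b′)
  (subst (+ n ℤ∣.∣_) (distrib l₁ l₂ a a′ b b′)
    (ℤ∣.∣m∣n⇒∣m+n (ℤ∣.∣n⇒∣m*n l₁ (≡[mod]⇒∣ a a′ a≡a′)) (ℤ∣.∣n⇒∣m*n l₂ (≡[mod]⇒∣ b b′ b≡b′))))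
  where
  distrib : ∀ l₁ l₂ a a′ b b′ → l₁ ℤ.* (a ℤ.- a′) ℤ.+ l₂ ℤ.* (b ℤ.- b′)
                             ≡ (l₁ ℤ.* a ℤ.+ l₂ ℤ.* b) ℤ.- (l₁ ℤ.* a′ ℤ.+ l₂ ℤ.* b′)
  distrib = solve-∀

mod-≡[mod] : ∀ m n .{{_ : ℕ.NonZero n}} → (+ toℕ (m mod n)) ≡[mod n ] (+ m)
mod-≡[mod] m n = ∣⇒≡[mod] (+ toℕ (m mod n)) (+ m) (ℤ∣.divides (ℤ.- + (m / n)) (begin
  + toℕ (m mod n) ℤ.- + m
    ≡⟨ cong₂ (λ a b → + a ℤ.- b) (toℕ-fromℕ< _) (cong +_ (m≡m%n+[m/n]*n m n)) ⟩
  + (m % n) ℤ.- + (m % n ℕ.+ m / n * n)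
    ≡⟨ cong (λ b → + (m % n) ℤ.- b) (pos-+-* (m % n) (m / n) n) ⟩
  + (m % n) ℤ.- (+ (m % n) ℤ.+ + (m / n) ℤ.* + n)
    ≡⟨ cancel (+ (m % n)) (+ (m / n)) (+ n) ⟩
  ℤ.- + (m / n) ℤ.* + n ∎))
  where
  open ≡-Reasoning
  cancel : ∀ r q n → r ℤ.- (r ℤ.+ q ℤ.* n) ≡ ℤ.- q ℤ.* n
  cancel = solve-∀

suc-mod≢mod : ∀ {n} .{{_ : ℕ.NonZero n}} a → 2 ≤ n → suc a mod n ≢ a mod n
suc-mod≢mod {n} a 2≤n eq = ℕₚ.<⇒≢ 2≤n (sym (∣1⇒≡1 n∣1))
  where
  r = + toℕ (a mod n)
  r≡suc-a : r ≡[mod n ] (+ suc a)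
  r≡suc-a = subst (λ x → (+ toℕ x) ≡[mod n ] (+ suc a)) eq (mod-≡[mod] (suc a) n)
  difference : ∀ r a → (r ℤ.- a) ℤ.- (r ℤ.- (1ℤ ℤ.+ a)) ≡ 1ℤ
  difference = solve-∀
  n∣1 : n ∣ 1
  n∣1 = ℤ∣.∣⇒∣ᵤ (subst (+ n ℤ∣.∣_) (difference r (+ a))
    (ℤ∣.∣m∣n⇒∣m-n (≡[mod]⇒∣ r (+ a) (mod-≡[mod] a n)) (≡[mod]⇒∣ r (+ suc a) r≡suc-a)))

bounded-divMod : ∀ d q z → z ≤ suc q * d → ∃₂ λ τ ρ → τ ≤ q × ρ ≤ d × z ≡ τ * d ℕ.+ ρ
bounded-divMod d zero z z≤d+0 = 0 , z , z≤n , ℕₚ.≤-trans z≤d+0 (ℕₚ.≤-reflexive (ℕₚ.+-identityʳ d)) , refl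
bounded-divMod d (suc q) z z≤ with z ≤? d
... | yes z≤d = 0 , z , z≤n , z≤d , refl
... | no z≰d with bounded-divMod d q (z ∸ d) (ℕₚ.m≤n+o⇒m∸n≤o z d z≤)
...   | τ , ρ , τ≤q , ρ≤d , z∸d≡ = suc τ , ρ , s≤s τ≤q , ρ≤d , (begin
  z                   ≡⟨ ℕₚ.m+[n∸m]≡n (ℕₚ.≰⇒≥ z≰d) ⟨
  d ℕ.+ (z ∸ d)       ≡⟨ cong (d ℕ.+_) z∸d≡ ⟩
  d ℕ.+ (τ * d ℕ.+ ρ) ≡⟨ ℕₚ.+-assoc d (τ * d) ρ ⟨
  suc τ * d ℕ.+ ρ     ∎)
  where open ≡-Reasoning

-- Both generators have ℤ₂-coordinate 1, so p is the ℤ₂-coordinate reached by l₁ r + l₂ (r − 1).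
Representation : ℕ → ℕ → ℤ → Set
Representation r′ p w = ∃₂ λ l₁ l₂ → ℤ.∣ l₁ ∣ ℕ.+ ℤ.∣ l₂ ∣ ≤ suc r′ * 2 ×
  (l₁ ℤ.+ l₂) ≡[mod 2 ] (+ p) × l₁ ℤ.* + suc r′ ℤ.+ l₂ ℤ.* + r′ ≡ w

representation-of-divMod : ∀ r′ p τ f z → p ≤ 1 → τ * 2 ℕ.+ p ≤ suc r′ * 2 → f ≤ suc r′ ℕ.+ r′ →
  z ℕ.+ r′ ≡ τ * (suc r′ ℕ.+ r′) ℕ.+ f ℕ.+ p * r′ → Representation r′ p (+ z)
representation-of-divMod r′ p τ f z p≤1 2τ+p≤2r f≤m z+r′≡ =
  l₁ , l₂ , norm≤ , parity , combination
  where
  T = + τ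
  F = + f
  R = + r′
  P = + p
  l₁ = T ℤ.+ F ℤ.- R
  l₂ = T ℤ.+ P ℤ.+ R ℤ.- F

  sum-identity : ∀ T F R P → (T ℤ.+ F ℤ.- R) ℤ.+ (T ℤ.+ P ℤ.+ R ℤ.- F) ≡ T ℤ.* + 2 ℤ.+ P
  sum-identity = solve-∀
  difference-identity : ∀ T F R P →
    (T ℤ.+ F ℤ.- R) ℤ.- (T ℤ.+ P ℤ.+ R ℤ.- F) ≡ F ℤ.* + 2 ℤ.- (R ℤ.* + 2 ℤ.+ P)
  difference-identity = solve-∀
  combination-identity : ∀ T F R P →
    (T ℤ.+ F ℤ.- R) ℤ.* (1ℤ ℤ.+ R) ℤ.+ (T ℤ.+ P ℤ.+ R ℤ.- F) ℤ.* R
      ≡ (T ℤ.* (1ℤ ℤ.+ R ℤ.+ R) ℤ.+ F ℤ.+ P ℤ.* R) ℤ.- R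
  combination-identity = solve-∀
  cancel : ∀ Z R → Z ℤ.+ R ℤ.- R ≡ Z
  cancel = solve-∀

  l₁+l₂≡ : l₁ ℤ.+ l₂ ≡ + (τ * 2 ℕ.+ p)
  l₁+l₂≡ = trans (sum-identity T F R P) (sym (pos-*-+ τ 2 p))

  l₁-l₂≡ : l₁ ℤ.- l₂ ≡ (f * 2) ⊖ (r′ * 2 ℕ.+ p)
  l₁-l₂≡ = begin
    l₁ ℤ.- l₂                              ≡⟨ difference-identity T F R P ⟩
    F ℤ.* + 2 ℤ.- (R ℤ.* + 2 ℤ.+ P)        ≡⟨ cong₂ ℤ._-_ (ℤₚ.pos-* f 2) (pos-*-+ r′ 2 p) ⟨
    + (f * 2) ℤ.- + (r′ * 2 ℕ.+ p)          ≡⟨ ℤₚ.m-n≡m⊖n (f * 2) (r′ * 2 ℕ.+ p) ⟩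
    (f * 2) ⊖ (r′ * 2 ℕ.+ p)               ∎
    where open ≡-Reasoning

  2f≤2r′+p+2r : f * 2 ≤ r′ * 2 ℕ.+ p ℕ.+ suc r′ * 2
  2f≤2r′+p+2r = begin
    f * 2                        ≤⟨ ℕₚ.*-monoˡ-≤ 2 f≤m ⟩
    (suc r′ ℕ.+ r′) * 2          ≡⟨ ℕₚ.*-distribʳ-+ 2 (suc r′) r′ ⟩
    suc r′ * 2 ℕ.+ r′ * 2        ≡⟨ ℕₚ.+-comm (suc r′ * 2) (r′ * 2) ⟩
    r′ * 2 ℕ.+ suc r′ * 2        ≤⟨ ℕₚ.+-monoˡ-≤ (suc r′ * 2) (ℕₚ.m≤m+n (r′ * 2) p) ⟩
    r′ * 2 ℕ.+ p ℕ.+ suc r′ * 2  ∎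
    where open ℕₚ.≤-Reasoning

  2r′+p≤2f+2r : r′ * 2 ℕ.+ p ≤ f * 2 ℕ.+ suc r′ * 2
  2r′+p≤2f+2r = begin
    r′ * 2 ℕ.+ p            ≤⟨ ℕₚ.+-monoʳ-≤ (r′ * 2) p≤1 ⟩
    r′ * 2 ℕ.+ 1            ≡⟨ ℕₚ.+-comm (r′ * 2) 1 ⟩
    suc (r′ * 2)            ≤⟨ ℕₚ.n≤1+n _ ⟩
    suc r′ * 2              ≤⟨ ℕₚ.m≤n+m (suc r′ * 2) (f * 2) ⟩
    f * 2 ℕ.+ suc r′ * 2    ∎
    where open ℕₚ.≤-Reasoning

  norm≤ : ℤ.∣ l₁ ∣ ℕ.+ ℤ.∣ l₂ ∣ ≤ suc r′ * 2
  norm≤ = ∣i+j∣≤n⇒∣i-j∣≤n⇒∣i∣+∣j∣≤n l₁ l₂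
    (subst (λ i → ℤ.∣ i ∣ ≤ suc r′ * 2) (sym l₁+l₂≡) 2τ+p≤2r)
    (subst (λ i → ℤ.∣ i ∣ ≤ suc r′ * 2) (sym l₁-l₂≡) (∣m⊖n∣≤o 2f≤2r′+p+2r 2r′+p≤2f+2r))

  parity : (l₁ ℤ.+ l₂) ≡[mod 2 ] P
  parity = ∣⇒≡[mod] (l₁ ℤ.+ l₂) P (ℤ∣.divides T
    (trans (cong (ℤ._- P) (sum-identity T F R P)) (cancel (T ℤ.* + 2) P)))

  z+r′≡ℤ : + z ℤ.+ R ≡ T ℤ.* (1ℤ ℤ.+ R ℤ.+ R) ℤ.+ F ℤ.+ P ℤ.* R
  z+r′≡ℤ = begin
    + z ℤ.+ R                                    ≡⟨ ℤₚ.pos-+ z r′ ⟨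
    + (z ℕ.+ r′)                                 ≡⟨ cong +_ z+r′≡ ⟩
    + (τ * (suc r′ ℕ.+ r′) ℕ.+ f ℕ.+ p * r′)     ≡⟨ ℤₚ.pos-+ _ (p * r′) ⟩
    + (τ * (suc r′ ℕ.+ r′) ℕ.+ f) ℤ.+ + (p * r′) ≡⟨ cong₂ ℤ._+_ (pos-*-+ τ (suc r′ ℕ.+ r′) f) (ℤₚ.pos-* p r′) ⟩
    T ℤ.* + (suc r′ ℕ.+ r′) ℤ.+ F ℤ.+ P ℤ.* R    ≡⟨ cong (λ m → T ℤ.* m ℤ.+ F ℤ.+ P ℤ.* R) (ℤₚ.pos-+ (suc r′) r′) ⟩
    T ℤ.* (1ℤ ℤ.+ R ℤ.+ R) ℤ.+ F ℤ.+ P ℤ.* R     ∎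
    where open ≡-Reasoning

  combination : l₁ ℤ.* + suc r′ ℤ.+ l₂ ℤ.* R ≡ + z
  combination = begin
    l₁ ℤ.* (1ℤ ℤ.+ R) ℤ.+ l₂ ℤ.* R                          ≡⟨ combination-identity T F R P ⟩
    (T ℤ.* (1ℤ ℤ.+ R ℤ.+ R) ℤ.+ F ℤ.+ P ℤ.* R) ℤ.- R         ≡⟨ cong (ℤ._- R) z+r′≡ℤ ⟨
    + z ℤ.+ R ℤ.- R                                           ≡⟨ cancel (+ z) R ⟩
    + z                                                       ∎
    where open ≡-Reasoning

representation-ℕ : ∀ r′ (p : Fin 2) z → z ≤ suc r′ * (suc r′ ℕ.+ r′) → Representation r′ (toℕ p) (+ z)
representation-ℕ r′ Fin.zero z z≤rm = from-division (bounded-divMod m (suc r′) (z ℕ.+ r′) z+r′≤[r+1]m)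
  where
  m = suc r′ ℕ.+ r′
  z+r′≤[r+1]m : z ℕ.+ r′ ≤ suc (suc r′) * m
  z+r′≤[r+1]m = ℕₚ.≤-trans (ℕₚ.+-mono-≤ z≤rm (ℕₚ.m≤n+m r′ (suc r′)))
    (ℕₚ.≤-reflexive (ℕₚ.+-comm (suc r′ * m) m))
  from-division : (∃₂ λ τ f → τ ≤ suc r′ × f ≤ m × z ℕ.+ r′ ≡ τ * m ℕ.+ f) → Representation r′ 0 (+ z)
  from-division (τ , f , τ≤r , f≤m , z+r′≡) =
    representation-of-divMod r′ 0 τ f z z≤n
      (ℕₚ.≤-trans (ℕₚ.≤-reflexive (ℕₚ.+-identityʳ (τ * 2))) (ℕₚ.*-monoˡ-≤ 2 τ≤r)) f≤m
      (trans z+r′≡ (sym (ℕₚ.+-identityʳ _)))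
representation-ℕ r′ (Fin.suc Fin.zero) z z≤rm = from-division (bounded-divMod m r′ z z≤rm)
  where
  m = suc r′ ℕ.+ r′
  from-division : (∃₂ λ τ f → τ ≤ r′ × f ≤ m × z ≡ τ * m ℕ.+ f) → Representation r′ 1 (+ z)
  from-division (τ , f , τ≤r′ , f≤m , z≡) =
    representation-of-divMod r′ 1 τ f z ℕₚ.≤-refl
      (ℕₚ.≤-trans (ℕₚ.≤-reflexive (ℕₚ.+-comm (τ * 2) 1))
        (ℕₚ.≤-trans (s≤s (ℕₚ.*-monoˡ-≤ 2 τ≤r′)) (ℕₚ.n≤1+n _))) f≤m
      (cong₂ ℕ._+_ z≡ (sym (ℕₚ.+-identityʳ r′)))

neg-representation : ∀ {r′ p w} → Representation r′ p w → Representation r′ p (ℤ.- w)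
neg-representation {r′} {p} (l₁ , l₂ , norm≤ , parity , combination) =
  ℤ.- l₁ , ℤ.- l₂ ,
  subst₂ (λ a b → a ℕ.+ b ≤ suc r′ * 2) (sym (ℤₚ.∣-i∣≡∣i∣ l₁)) (sym (ℤₚ.∣-i∣≡∣i∣ l₂)) norm≤ ,
  subst (λ i → i ≡[mod 2 ] (+ p)) (ℤₚ.neg-distrib-+ l₁ l₂)
    (≡[mod]-trans (ℤ.- (l₁ ℤ.+ l₂)) (ℤ.- + p) (+ p)
      (-‿cong-≡[mod] (l₁ ℤ.+ l₂) (+ p) parity) (-i≡i[mod2] (+ p))) ,
  trans (negate l₁ l₂ (+ suc r′) (+ r′)) (cong ℤ.-_ combination)
  where
  negate : ∀ l₁ l₂ a b → ℤ.- l₁ ℤ.* a ℤ.+ ℤ.- l₂ ℤ.* b ≡ ℤ.- (l₁ ℤ.* a ℤ.+ l₂ ℤ.* b)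
  negate = solve-∀

representation : ∀ r′ (p : Fin 2) w → ℤ.∣ w ∣ ≤ suc r′ * (suc r′ ℕ.+ r′) → Representation r′ (toℕ p) w
representation r′ p (+ z)    ∣w∣≤rm = representation-ℕ r′ p z ∣w∣≤rm
representation r′ p -[1+ z ] ∣w∣≤rm = neg-representation (representation-ℕ r′ p (suc z) ∣w∣≤rm)

small-representative : ∀ {n R} y → y < n → n ≤ 2 * R → ∃ λ w → ℤ.∣ w ∣ ≤ R × w ≡[mod n ] (+ y)
small-representative {n} {R} y y<n n≤2R with y ≤? R
... | yes y≤R = + y , y≤R , ≡⇒≡[mod] (+ y) (+ y) refl
... | no y≰R = y ⊖ n , ∣m⊖n∣≤o y≤n+R n≤y+R ,
  ∣⇒≡[mod] (y ⊖ n) (+ y) (ℤ∣.divides ℤ.-1ℤ (trans (cong (ℤ._- + y) (sym (ℤₚ.m-n≡m⊖n y n))) (cancel (+ y) (+ n))))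
  where
  y≤n+R : y ≤ n ℕ.+ R
  y≤n+R = ℕₚ.≤-trans (ℕₚ.<⇒≤ y<n) (ℕₚ.m≤m+n n R)
  n≤y+R : n ≤ y ℕ.+ R
  n≤y+R = begin
    n               ≤⟨ n≤2R ⟩
    R ℕ.+ (R ℕ.+ 0) ≡⟨ cong (R ℕ.+_) (ℕₚ.+-identityʳ R) ⟩
    R ℕ.+ R         ≤⟨ ℕₚ.+-monoˡ-≤ R (ℕₚ.<⇒≤ (ℕₚ.≰⇒> y≰R)) ⟩
    y ℕ.+ R         ∎
    where open ℕₚ.≤-Reasoning
  cancel : ∀ y n → y ℤ.- n ℤ.- y ≡ ℤ.-1ℤ ℤ.* n
  cancel = solve-∀

generator : ∀ k′ → ℕ → G (suc k′)
generator k′ a = Fin.suc Fin.zero , a mod (2 * suc k′)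

generators-spanning : ∀ k′ r′ → suc k′ ≤ suc r′ * (suc r′ ℕ.+ r′) →
  IsSSpanning (suc k′) (suc r′ * 2) (generator k′ (suc r′)) (generator k′ r′)
generators-spanning k′ r′ k≤rm (x , y)
  with w , ∣w∣≤rm , w≡y ← small-representative (toℕ y) (toℕ<n y) (ℕₚ.*-monoʳ-≤ 2 k≤rm)
  with l₁ , l₂ , norm≤ , parity , combination ← representation r′ x w ∣w∣≤rm =
  l₁ , l₂ , norm≤ ,
  subst (λ i → i ≡[mod 2 ] (+ toℕ x)) (sym (cong₂ ℤ._+_ (ℤₚ.*-identityʳ l₁) (ℤₚ.*-identityʳ l₂))) parity ,
  ≡[mod]-trans (l₁ ℤ.* a ℤ.+ l₂ ℤ.* b) w (+ toℕ y)
    (subst (λ v → (l₁ ℤ.* a ℤ.+ l₂ ℤ.* b) ≡[mod n ] v) combination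
      (lincomb-≡[mod] l₁ l₂ a (+ suc r′) b (+ r′) (mod-≡[mod] (suc r′) n) (mod-≡[mod] r′ n)))
    w≡y
  where
  n = 2 * suc k′
  a = + toℕ (suc r′ mod n)
  b = + toℕ (r′ mod n)

[s*s∸s]/2≡r*[2r-1] : ∀ r′ → let s = suc r′ * 2 in (s * s ∸ s) / 2 ≡ suc r′ * (suc r′ ℕ.+ r′)
[s*s∸s]/2≡r*[2r-1] r′ = begin
  (s * s ∸ s) / 2             ≡⟨ cong (λ t → (t ∸ s) / 2) (square r′) ⟩
  (rm * 2 ℕ.+ s ∸ s) / 2      ≡⟨ cong (_/ 2) (ℕₚ.m+n∸n≡m (rm * 2) s) ⟩
  rm * 2 / 2                  ≡⟨ DM.m*n/n≡m rm 2 ⟩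
  rm                          ∎
  where
  open ≡-Reasoning
  s = suc r′ * 2
  rm = suc r′ * (suc r′ ℕ.+ r′)
  square : ∀ x → ((1 ℕ.+ x) * 2) * ((1 ℕ.+ x) * 2) ≡ ((1 ℕ.+ x) * ((1 ℕ.+ x) ℕ.+ x)) * 2 ℕ.+ (1 ℕ.+ x) * 2
  square = ℕsolve-∀

mainTheorem13 : (k s : ℕ) → 1 ≤ k → 1 ≤ s → 2 ∣ s → k ≤ (s * s ∸ s) / 2 →
    HasSSpanningSetOfSize2 k s
mainTheorem13 k .(0 * 2) _ () (divides zero refl) _
mainTheorem13 (suc k′) .(suc r′ * 2) _ _ (divides (suc r′) refl) k≤ =
  generator k′ (suc r′) , generator k′ r′ , generators-distinct ,
  generators-spanning k′ r′ (ℕₚ.≤-trans k≤ (ℕₚ.≤-reflexive ([s*s∸s]/2≡r*[2r-1] r′)))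
  where
  generators-distinct : generator k′ (suc r′) ≢ generator k′ r′
  generators-distinct eq = suc-mod≢mod r′ (ℕₚ.*-monoʳ-≤ 2 (s≤s z≤n)) (cong proj₂ eq)
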